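{- Let $p$ be a prime, let $H$ be a finite Abelian $p$-group, and let $G\simeq C_p\oplus H$. Let $S$ be a normal sequence over $G$ with $|S|=\mathsf{D}(G)+i-1$, where $i\in\{1,\dots,p-1\}$. Then $S=0^iT$, i.e. $S$ consists of $i$ copies of $0\in G$ together with a zero-sumfree sequence $T$ over $G$.
   Context: $C_p$ denotes the cyclic group of order $p$. A sequence over a finite Abelian group $G$ (written additively) is a finite unordered list of elements of $G$ with repetitions allowed, written multiplicatively, with length $|S|$ the number of terms; $0^iT$ denotes the concatenation of $i$ copies of $0$ with $T$. A subsequence is a sub-multiset. A sequence is zero-sum if the sum of its terms is $0$, and zero-sumfree if no non-empty subsequence has sum $0$. The Davenport constant $\mathsf{D}(G)$ is the smallest positive integer $t$ such that every sequence over $G$ of length at least $t$ contains a non-empty zero-sum subsequence. A sequence $S$ over $G$ with $|S|\ge\mathsf{D}(G)$ is normal if every zero-sum subsequence $S'$ of $S$ satisfies $|S'|\le |S|-\mathsf{D}(G)+1$. -}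

module Defs where

open import Data.Nat using (ℕ; zero; suc; _+_; _^_; _≤_; _∸_; _≥_)
open import Data.Nat.Divisibility using (_∣_)
open import Data.Fin using (Fin; toℕ)
import Data.Fin as F
open import Data.List using (List; []; _∷_; length; _++_)
open import Data.List.Relation.Unary.All using (All)
open import Data.List.Relation.Binary.Sublist.Propositional using (_⊆_)
open import Data.List.Relation.Binary.Permutation.Propositional using (_↭_)
open import Data.Product using (Σ; _×_; ∃; ∃-syntax)
open import Relation.Binary.PropositionalEquality using (_≡_)
open import Relation.Nullary using (¬_)

-- The group  G = C_p ⊕ C_{p^{e 0}} ⊕ ... ⊕ C_{p^{e (r-1)}}  (the finite abelian
-- p-group H is given by its cyclic decomposition  H = ⊕_k C_{p^{e k}}).
modulus : (p r : ℕ) (e : Fin r → ℕ) → Fin (suc r) → ℕ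
modulus p r e F.zero    = p
modulus p r e (F.suc k) = p ^ e k

Elem : (p r : ℕ) (e : Fin r → ℕ) → Set
Elem p r e = (k : Fin (suc r)) → Fin (modulus p r e k)

-- A sequence over G (unordered; we use lists, considered up to permutation).
Seq : (p r : ℕ) (e : Fin r → ℕ) → Set
Seq p r e = List (Elem p r e)

-- the k-th coordinate of the sum (as a natural number, before reduction)
coordSum : {p r : ℕ} {e : Fin r → ℕ} → Fin (suc r) → Seq p r e → ℕ
coordSum k []      = 0
coordSum k (g ∷ S) = toℕ (g k) + coordSum k S

IsZeroElem : {p r : ℕ} {e : Fin r → ℕ} → Elem p r e → Set
IsZeroElem g = ∀ k → toℕ (g k) ≡ 0

ZeroSum : {p r : ℕ} {e : Fin r → ℕ} → Seq p r e → Set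
ZeroSum {p} {r} {e} S = ∀ k → modulus p r e k ∣ coordSum k S

NonEmpty : {A : Set} → List A → Set
NonEmpty S = 1 ≤ length S

ZeroSumFree : {p r : ℕ} {e : Fin r → ℕ} → Seq p r e → Set
ZeroSumFree S = ∀ S' → S' ⊆ S → NonEmpty S' → ¬ ZeroSum S'

ForcesZeroSum : (p r : ℕ) (e : Fin r → ℕ) → ℕ → Set
ForcesZeroSum p r e t =
  ∀ (S : Seq p r e) → length S ≥ t →
    ∃[ S' ] (S' ⊆ S × NonEmpty S' × ZeroSum S')

IsDavenport : (p r : ℕ) (e : Fin r → ℕ) → ℕ → Set
IsDavenport p r e D =
  1 ≤ D × ForcesZeroSum p r e D ×
  (∀ t → 1 ≤ t → ForcesZeroSum p r e t → D ≤ t)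

Normal : {p r : ℕ} {e : Fin r → ℕ} → ℕ → Seq p r e → Set
Normal D S =
  length S ≥ D ×
  (∀ S' → S' ⊆ S → ZeroSum S' → length S' ≤ length S ∸ D + 1)

module Submission where

-- Corollary 2.2.  Write G = C_p ⊕ H = ⊕_k ℤ/M_k with every M_k a power of the
-- prime p, and let S be a normal sequence with |S| = D(G) + i - 1, 1 ≤ i ≤ p-1.
-- Split S into its zero terms Z and the rest T.  Normality bounds every
-- zero-sum subsequence of S by i; so |Z| ≤ i, and |U| + |Z| ≤ i for every
-- zero-sum U ⊆ T.  If |Z| = j < i, then T has length D + b with b = i - j - 1,
-- b + 1 < p, and all non-empty zero-sum subsequences of T have length in
-- [2, b + 1].  The main lemma `no-medium-zero-sums` excludes this by Olson's
-- method: the function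
--   F(x) = Σ_{U ⊆ T} (-1)^{|U|} φ(|T| - |U|) [x - σ(U) ∈ ⊕_k M_k ℤ],
--   φ(w) = Π_{m<b} (w - (D-1) - m),
-- arises from a lattice-periodic function by |T| - b ≥ D*(G) difference
-- operators, so it vanishes mod p (by pigeonhole and the Frobenius identity
-- Δ_a^{p^m} ≡ Δ_{p^m a}); yet F(0) = φ(|T|) = (b+1)! is prime to p.  Hence
-- |Z| = i, and normality then leaves no room for a zero-sum U ⊆ T.

open import Defs
open import Data.Nat using (ℕ; _^_)
open import Data.Nat.Primality using (Prime)
open import Data.Fin using (Fin)
open import Data.Product using (∃-syntax)
open import Relation.Binary.PropositionalEquality using (_≡_)

-- Binomial coefficients modulo a prime: the only arithmetic input to the
-- Frobenius identity for difference operators.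
module Binomials where
  open import Data.Nat using (zero; suc; _+_; _*_; _<_; s≤s; z≤n)
  open import Data.Nat.Properties
    using (*-distribˡ-+; *-identityˡ; *-identityʳ; *-zeroʳ; +-assoc; *-comm; <⇒≱)
  open import Data.Nat.Combinatorics
    using (_C_; nC1≡n; k>n⇒nCk≡0; nCk+nC[k+1]≡[n+1]C[k+1])
  open import Data.Nat.Divisibility using (_∣_; divides; ∣⇒≤)
  open import Data.Nat.Primality using (euclidsLemma)
  open import Data.Sum using (inj₁; inj₂)
  open import Data.Empty using (⊥-elim)
  open import Relation.Binary.PropositionalEquality using (refl; trans; cong; cong₂; module ≡-Reasoning)

  absorption : ∀ m k → suc k * (suc m C suc k) ≡ suc m * (m C k)
  absorption zero    zero    = refl
  absorption zero    (suc k) = begin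
    suc (suc k) * (1 C suc (suc k))  ≡⟨ cong (suc (suc k) *_) (k>n⇒nCk≡0 {1} {suc (suc k)} (s≤s (s≤s z≤n))) ⟩
    suc (suc k) * 0                  ≡⟨ *-zeroʳ (suc (suc k)) ⟩
    0                                ≡⟨ cong (1 *_) (k>n⇒nCk≡0 {0} {suc k} (s≤s z≤n)) ⟨
    1 * (0 C suc k)                  ∎
    where open ≡-Reasoning
  absorption (suc m) zero    = begin
    1 * (suc (suc m) C 1)  ≡⟨ *-identityˡ _ ⟩
    suc (suc m) C 1        ≡⟨ nC1≡n (suc (suc m)) ⟩
    suc (suc m)            ≡⟨ *-identityʳ (suc (suc m)) ⟨
    suc (suc m) * 1        ∎
    where open ≡-Reasoning
  absorption (suc m) (suc k) = begin
    suc (suc k) * (suc (suc m) C suc (suc k))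
      ≡⟨ cong (suc (suc k) *_) (nCk+nC[k+1]≡[n+1]C[k+1] (suc m) (suc k)) ⟨
    suc (suc k) * (a + b)
      ≡⟨ *-distribˡ-+ (suc (suc k)) a b ⟩
    (a + suc k * a) + suc (suc k) * b
      ≡⟨ cong₂ (λ u v → (a + u) + v) (absorption m k) (absorption m (suc k)) ⟩
    (a + suc m * (m C k)) + suc m * (m C suc k)
      ≡⟨ +-assoc a _ _ ⟩
    a + (suc m * (m C k) + suc m * (m C suc k))
      ≡⟨ cong (a +_) (*-distribˡ-+ (suc m) (m C k) (m C suc k)) ⟨
    a + suc m * (m C k + m C suc k)
      ≡⟨ cong (λ c → a + suc m * c) (nCk+nC[k+1]≡[n+1]C[k+1] m k) ⟩
    suc (suc m) * (suc m C suc k)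
      ∎
    where
      open ≡-Reasoning
      a = suc m C suc k
      b = suc m C suc (suc k)

  -- p divides C(p,i) for 0 < i < p: by absorption p divides i·C(p,i),
  -- and p does not divide i.
  prime∣binomial : ∀ {p} → Prime p → ∀ i → 0 < i → i < p → p ∣ p C i
  prime∣binomial {suc m} isPrime (suc k) _ i<p
    with euclidsLemma (suc k) (suc m C suc k) isPrime
           (divides (m C k) (trans (absorption m k) (*-comm (suc m) (m C k))))
  ... | inj₁ p∣i = ⊥-elim (<⇒≱ i<p (∣⇒≤ p∣i))
  ... | inj₂ p∣C = p∣C

module IntegerSums where
  open import Data.Nat as ℕ using (zero; suc; _<_; s≤s; z≤n)
  import Data.Nat.Divisibility as ℕ
  open import Data.Nat.Primality using (prime⇒irreducible)
  open import Data.Integer using (ℤ; +_; -_; _+_; _-_; 0ℤ; 1ℤ; -1ℤ)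
  import Data.Integer.Properties as ℤ
  open import Data.Integer.Divisibility.Signed using (_∣_; divides; ∣m∣n⇒∣m+n)
  open import Data.Integer.Tactic.RingSolver using (solve-∀)
  open import Data.Sum using (_⊎_; inj₁; inj₂)
  open import Data.Product using (_×_; _,_)
  open import Relation.Binary.PropositionalEquality using (refl; sym; trans; cong; cong₂)

  sign : ℕ → ℤ
  sign zero    = 1ℤ
  sign (suc i) = - sign i

  sign-parity : ∀ m → (sign m ≡ 1ℤ × 2 ℕ.∣ m) ⊎ (sign m ≡ -1ℤ × 2 ℕ.∣ suc m)
  sign-parity zero    = inj₁ (refl , ℕ.divides 0 refl)
  sign-parity (suc m) with sign-parity m
  ... | inj₁ (s≡1 , 2∣m)   = inj₂ (cong -_ s≡1 , ℕ.∣m∣n⇒∣m+n (ℕ.∣-refl {2}) 2∣m)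
  ... | inj₂ (s≡-1 , 2∣m+1) = inj₁ (cong -_ s≡-1 , 2∣m+1)

  -- (-1)^p ≡ -1 (mod p) for every prime p; for p = 2 because 1 ≡ -1 (mod 2).
  prime∣sign+1 : ∀ {p} → Prime p → (+ p) ∣ (sign p + 1ℤ)
  prime∣sign+1 {p} isPrime with sign-parity p
  ... | inj₂ (s≡-1 , _) = divides 0ℤ (trans (cong (_+ 1ℤ) s≡-1) (sym (ℤ.*-zeroˡ (+ p))))
  ... | inj₁ (s≡1 , 2∣p) with prime⇒irreducible isPrime 2∣p
  ...   | inj₁ ()
  ...   | inj₂ refl = divides 1ℤ (cong (_+ 1ℤ) s≡1)

  sumBelow : ℕ → (ℕ → ℤ) → ℤ
  sumBelow zero    f = 0ℤ
  sumBelow (suc m) f = f 0 + sumBelow m (λ i → f (suc i))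

  sumBelow-cong : ∀ m {f g} → (∀ i → f i ≡ g i) → sumBelow m f ≡ sumBelow m g
  sumBelow-cong zero    f≡g = refl
  sumBelow-cong (suc m) f≡g = cong₂ _+_ (f≡g 0) (sumBelow-cong m (λ i → f≡g (suc i)))

  sumBelow-sub : ∀ m f g → sumBelow m f - sumBelow m g ≡ sumBelow m (λ i → f i - g i)
  sumBelow-sub zero    f g = refl
  sumBelow-sub (suc m) f g =
    trans (regroup (f 0) (g 0) (sumBelow m _) (sumBelow m _))
          (cong (λ s → (f 0 - g 0) + s) (sumBelow-sub m (λ i → f (suc i)) (λ i → g (suc i))))
    where regroup : ∀ a b c d → (a + c) - (b + d) ≡ (a - b) + (c - d)
          regroup = solve-∀

  sumBelow-last : ∀ m f → sumBelow (suc m) f ≡ sumBelow m f + f m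
  sumBelow-last zero    f = ℤ.+-comm (f 0) 0ℤ
  sumBelow-last (suc m) f =
    trans (cong (λ s → f 0 + s) (sumBelow-last m (λ i → f (suc i)))) (sym (ℤ.+-assoc (f 0) _ _))

  sumBelow-divisible : ∀ {d} m f → (∀ i → i < m → d ∣ f i) → d ∣ sumBelow m f
  sumBelow-divisible zero    f _  = divides 0ℤ refl
  sumBelow-divisible (suc m) f d∣ =
    ∣m∣n⇒∣m+n (d∣ 0 (s≤s z≤n)) (sumBelow-divisible m _ (λ i i<m → d∣ (suc i) (s≤s i<m)))

module Points where
  open import Data.Nat as ℕ using (suc)
  open import Data.Integer using (ℤ; +_; _+_; _-_; _*_; 0ℤ; 1ℤ)
  import Data.Integer.Properties as ℤ
  open import Data.Integer.Tactic.RingSolver using (solve-∀)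
  open import Data.Vec using (Vec; []; _∷_; zipWith; map; replicate)
  open import Relation.Binary.PropositionalEquality using (refl; sym; trans; cong; cong₂)

  infixl 6 _⊖_ _⊕_
  infixr 7 _·_

  _⊖_ _⊕_ : ∀ {n} → Vec ℤ n → Vec ℤ n → Vec ℤ n
  _⊖_ = zipWith _-_
  _⊕_ = zipWith _+_

  _·_ : ∀ {n} → ℕ → Vec ℤ n → Vec ℤ n
  c · a = map (λ z → + c * z) a

  origin : ∀ {n} → Vec ℤ n
  origin = replicate _ 0ℤ

  ⊖-comm : ∀ {n} (x a b : Vec ℤ n) → x ⊖ a ⊖ b ≡ x ⊖ b ⊖ a
  ⊖-comm []       []       []       = refl
  ⊖-comm (x ∷ xs) (a ∷ as) (b ∷ bs) = cong₂ _∷_ (swap x a b) (⊖-comm xs as bs)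
    where swap : ∀ x a b → x - a - b ≡ x - b - a
          swap = solve-∀

  ⊖-⊕ : ∀ {n} (x a b : Vec ℤ n) → x ⊖ a ⊖ b ≡ x ⊖ (a ⊕ b)
  ⊖-⊕ []       []       []       = refl
  ⊖-⊕ (x ∷ xs) (a ∷ as) (b ∷ bs) = cong₂ _∷_ (merge x a b) (⊖-⊕ xs as bs)
    where merge : ∀ x a b → x - a - b ≡ x - (a + b)
          merge = solve-∀

  ⊖-origin : ∀ {n} (x : Vec ℤ n) → x ⊖ origin ≡ x
  ⊖-origin []       = refl
  ⊖-origin (x ∷ xs) = cong₂ _∷_ (ℤ.+-identityʳ x) (⊖-origin xs)

  ⊖-0· : ∀ {n} (x a : Vec ℤ n) → x ⊖ 0 · a ≡ x
  ⊖-0· []       []       = refl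
  ⊖-0· (x ∷ xs) (a ∷ as) = cong₂ _∷_ (cancel x a) (⊖-0· xs as)
    where cancel : ∀ x a → x - 0ℤ * a ≡ x
          cancel = solve-∀

  ⊖-suc· : ∀ {n} i (x a : Vec ℤ n) → x ⊖ a ⊖ i · a ≡ x ⊖ suc i · a
  ⊖-suc· i []       []       = refl
  ⊖-suc· i (x ∷ xs) (a ∷ as) = cong₂ _∷_ (shift x a (+ i)) (⊖-suc· i xs as)
    where shift : ∀ x a i → x - a - i * a ≡ x - (1ℤ + i) * a
          shift = solve-∀

  ·-· : ∀ {n} i j (a : Vec ℤ n) → i · j · a ≡ (i ℕ.* j) · a
  ·-· i j []       = refl
  ·-· i j (a ∷ as) =
    cong₂ _∷_ (trans (sym (ℤ.*-assoc (+ i) (+ j) a)) (cong (_* a) (sym (ℤ.pos-* i j)))) (·-· i j as)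

  1· : ∀ {n} (a : Vec ℤ n) → 1 · a ≡ a
  1· []       = refl
  1· (a ∷ as) = cong₂ _∷_ (ℤ.*-identityˡ a) (1· as)

-- Difference operators on integer-valued functions on ℤⁿ, and the Frobenius
-- identity  Δ_a^{p^m} h ≡ Δ_{p^m a} h  (mod p), which holds because p
-- divides C(p,i) for 0 < i < p.
module Differences (p : ℕ) {n : ℕ} where
  open import Data.Nat as ℕ using (zero; suc; _<_; s≤s; z≤n)
  import Data.Nat.Properties as ℕ
  open import Data.Nat.Combinatorics using (_C_; nCn≡1; k>n⇒nCk≡0; nCk+nC[k+1]≡[n+1]C[k+1])
  open import Data.Nat.Primality using (prime⇒nonZero)
  open import Data.Integer using (ℤ; +_; -_; _+_; _-_; _*_; 0ℤ; 1ℤ)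
  import Data.Integer.Properties as ℤ
  open import Data.Integer.Divisibility.Signed
    using (_∣_; divides; ∣m∣n⇒∣m+n; ∣m∣n⇒∣m-n; ∣n⇒∣m*n; ∣m⇒∣m*n; ∣ᵤ⇒∣)
  open import Data.Integer.Tactic.RingSolver using (solve-∀)
  open import Data.Vec using (Vec)
  open import Relation.Binary.PropositionalEquality
    using (_≗_; refl; sym; trans; cong; cong₂; subst; module ≡-Reasoning)
  open Binomials
  open IntegerSums
  open Points

  Fn : Set
  Fn = Vec ℤ n → ℤ

  Δ : Vec ℤ n → Fn → Fn
  Δ a h x = h x - h (x ⊖ a)

  Δ^ : ℕ → Vec ℤ n → Fn → Fn
  Δ^ zero    a h = h
  Δ^ (suc j) a h = Δ a (Δ^ j a h)

  Vanishes : Fn → Set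
  Vanishes h = ∀ x → (+ p) ∣ h x

  -- congruence modulo p of functions (a record, so that both sides are inferable)
  record _≡ₚ_ (h h' : Fn) : Set where
    constructor congruent
    field difference-divisible : ∀ x → (+ p) ∣ (h x - h' x)

  Δ-cong : ∀ a {h h'} → h ≗ h' → Δ a h ≗ Δ a h'
  Δ-cong a h≗h' x = cong₂ _-_ (h≗h' x) (h≗h' (x ⊖ a))

  Δ-comm : ∀ a b h → Δ a (Δ b h) ≗ Δ b (Δ a h)
  Δ-comm a b h x =
    trans (cong (λ y → (h x - h (x ⊖ b)) - (h (x ⊖ a) - h y)) (⊖-comm x a b))
          (exchange (h x) (h (x ⊖ b)) (h (x ⊖ a)) (h (x ⊖ b ⊖ a)))
    where exchange : ∀ u v w z → (u - v) - (w - z) ≡ (u - w) - (v - z)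
          exchange = solve-∀

  Δ^-+ : ∀ i j a h → Δ^ (i ℕ.+ j) a h ≗ Δ^ i a (Δ^ j a h)
  Δ^-+ zero    j a h x = refl
  Δ^-+ (suc i) j a h   = Δ-cong a (Δ^-+ i j a h)

  Δ-vanishes : ∀ a {h} → Vanishes h → Vanishes (Δ a h)
  Δ-vanishes a van x = ∣m∣n⇒∣m-n (van x) (van (x ⊖ a))

  Δ^-vanishes : ∀ j a {h} → Vanishes h → Vanishes (Δ^ j a h)
  Δ^-vanishes zero    a van = van
  Δ^-vanishes (suc j) a van = Δ-vanishes a (Δ^-vanishes j a van)

  ≗⇒≡ₚ : ∀ {h h'} → h ≗ h' → h ≡ₚ h'
  ≗⇒≡ₚ {h} {h'} h≗h' = congruent λ x →
    divides 0ℤ (trans (cong (_- h' x) (h≗h' x)) (trans (ℤ.+-inverseʳ (h' x)) (sym (ℤ.*-zeroˡ (+ p)))))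

  ≡ₚ-trans : ∀ {f g h} → f ≡ₚ g → g ≡ₚ h → f ≡ₚ h
  ≡ₚ-trans {f} {g} {h} (congruent f≡g) (congruent g≡h) = congruent λ x →
    subst ((+ p) ∣_) (telescope (f x) (g x) (h x)) (∣m∣n⇒∣m+n (f≡g x) (g≡h x))
    where telescope : ∀ u v w → (u - v) + (v - w) ≡ u - w
          telescope = solve-∀

  ≡ₚ-vanishes : ∀ {h h'} → h ≡ₚ h' → Vanishes h' → Vanishes h
  ≡ₚ-vanishes {h} {h'} (congruent h≡h') van x =
    subst ((+ p) ∣_) (cancel (h x) (h' x)) (∣m∣n⇒∣m+n (h≡h' x) (van x))
    where cancel : ∀ u v → (u - v) + v ≡ u
          cancel = solve-∀

  Δ-≡ₚ : ∀ a {h h'} → h ≡ₚ h' → Δ a h ≡ₚ Δ a h'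
  Δ-≡ₚ a {h} {h'} (congruent h≡h') = congruent λ x →
    subst ((+ p) ∣_) (exchange (h x) (h' x) (h (x ⊖ a)) (h' (x ⊖ a)))
          (∣m∣n⇒∣m-n (h≡h' x) (h≡h' (x ⊖ a)))
    where exchange : ∀ u v w z → (u - v) - (w - z) ≡ (u - w) - (v - z)
          exchange = solve-∀

  Δ^-≡ₚ : ∀ j a {h h'} → h ≡ₚ h' → Δ^ j a h ≡ₚ Δ^ j a h'
  Δ^-≡ₚ zero    a h≡h' = h≡h'
  Δ^-≡ₚ (suc j) a h≡h' = Δ-≡ₚ a (Δ^-≡ₚ j a h≡h')

  binomialTerm : ℕ → Vec ℤ n → Fn → Vec ℤ n → ℕ → ℤ
  binomialTerm j a h x i = sign i * + (j C i) * h (x ⊖ i · a)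

  binomialTerm-top : ∀ j a h x → binomialTerm j a h x (suc j) ≡ 0ℤ
  binomialTerm-top j a h x =
    trans (cong (λ c → sign (suc j) * + c * h (x ⊖ suc j · a)) (k>n⇒nCk≡0 {j} {suc j} (ℕ.n<1+n j)))
          (trans (cong (_* h (x ⊖ suc j · a)) (ℤ.*-zeroʳ (sign (suc j)))) (ℤ.*-zeroˡ (h (x ⊖ suc j · a))))

  -- Pascal's rule, in the form needed to pass from Δ_a^j to Δ_a^{j+1}
  binomialTerm-pascal : ∀ j a h x i →
    binomialTerm j a h x (suc i) - binomialTerm j a h (x ⊖ a) i ≡ binomialTerm (suc j) a h x (suc i)
  binomialTerm-pascal j a h x i = begin
    sign (suc i) * + (j C suc i) * H - sign i * + (j C i) * h (x ⊖ a ⊖ i · a)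
      ≡⟨ cong (λ y → sign (suc i) * + (j C suc i) * H - sign i * + (j C i) * h y) (⊖-suc· i x a) ⟩
    sign (suc i) * + (j C suc i) * H - sign i * + (j C i) * H
      ≡⟨ collect (sign i) (+ (j C i)) (+ (j C suc i)) H ⟩
    sign (suc i) * (+ (j C i) + + (j C suc i)) * H
      ≡⟨ cong (λ c → sign (suc i) * c * H)
              (trans (sym (ℤ.pos-+ (j C i) (j C suc i))) (cong +_ (nCk+nC[k+1]≡[n+1]C[k+1] j i))) ⟩
    sign (suc i) * + (suc j C suc i) * H
      ∎
    where
      open ≡-Reasoning
      H = h (x ⊖ suc i · a)
      collect : ∀ s c c' H → (- s) * c' * H - s * c * H ≡ (- s) * (c + c') * H
      collect = solve-∀

  binomialExpansion : ∀ j a h x → Δ^ j a h x ≡ sumBelow (suc j) (binomialTerm j a h x)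
  binomialExpansion zero    a h x = sym (trans (ℤ.+-identityʳ _)
    (trans (ℤ.*-identityˡ (h (x ⊖ 0 · a))) (cong h (⊖-0· x a))))
  binomialExpansion (suc j) a h x = begin
    Δ^ j a h x - Δ^ j a h (x ⊖ a)
      ≡⟨ cong₂ _-_ (binomialExpansion j a h x) (binomialExpansion j a h (x ⊖ a)) ⟩
    sumBelow (suc j) T - sumBelow (suc j) T⁻
      ≡⟨ cong (_- sumBelow (suc j) T⁻) (sym with-top-term) ⟩
    sumBelow (suc (suc j)) T - sumBelow (suc j) T⁻
      ≡⟨ regroup (T 0) (sumBelow (suc j) (λ i → T (suc i))) (sumBelow (suc j) T⁻) ⟩
    T 0 + (sumBelow (suc j) (λ i → T (suc i)) - sumBelow (suc j) T⁻)
      ≡⟨ cong (λ s → T 0 + s) (sumBelow-sub (suc j) (λ i → T (suc i)) T⁻) ⟩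
    T 0 + sumBelow (suc j) (λ i → T (suc i) - T⁻ i)
      ≡⟨ cong (λ s → T 0 + s) (sumBelow-cong (suc j) (binomialTerm-pascal j a h x)) ⟩
    sumBelow (suc (suc j)) (binomialTerm (suc j) a h x)
      ∎
    where
      open ≡-Reasoning
      T T⁻ : ℕ → ℤ
      T  = binomialTerm j a h x
      T⁻ = binomialTerm j a h (x ⊖ a)
      with-top-term : sumBelow (suc (suc j)) T ≡ sumBelow (suc j) T
      with-top-term = trans (sumBelow-last (suc j) T)
        (trans (cong (λ t → sumBelow (suc j) T + t) (binomialTerm-top j a h x)) (ℤ.+-identityʳ _))
      regroup : ∀ u v w → (u + v) - w ≡ u + (v - w)
      regroup = solve-∀

  -- Pointwise form of the Frobenius identity below: in the binomial expansion
  -- of Δ_a^p the middle terms carry C(p,i) ≡ 0 and the last one (-1)^p ≡ -1.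
  frobenius-at : Prime p → ∀ a h x → (+ p) ∣ (Δ^ p a h x - Δ (p · a) h x)
  frobenius-at isPrime a h x = subst ((+ p) ∣_) (sym difference) divisible
    where
      open ≡-Reasoning
      T : ℕ → ℤ
      T = binomialTerm p a h x
      H = h (x ⊖ p · a)
      q = ℕ.pred p
      q+1≡p : suc q ≡ p
      q+1≡p = ℕ.suc-pred p ⦃ prime⇒nonZero isPrime ⦄
      inner = sumBelow q (λ i → T (suc i))
      tail-split : sumBelow p (λ i → T (suc i)) ≡ inner + T p
      tail-split = subst (λ m → sumBelow m (λ i → T (suc i)) ≡ inner + T m) q+1≡p
                         (sumBelow-last q (λ i → T (suc i)))
      first : T 0 ≡ h x
      first = trans (ℤ.*-identityˡ (h (x ⊖ 0 · a))) (cong h (⊖-0· x a))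
      last : T p ≡ sign p * 1ℤ * H
      last = cong (λ c → sign p * + c * H) (nCn≡1 p)
      difference : Δ^ p a h x - Δ (p · a) h x ≡ inner + (sign p + 1ℤ) * H
      difference = begin
        Δ^ p a h x - (h x - H)
          ≡⟨ cong (_- (h x - H)) (binomialExpansion p a h x) ⟩
        (T 0 + sumBelow p (λ i → T (suc i))) - (h x - H)
          ≡⟨ cong₂ (λ u v → (u + v) - (h x - H)) first (trans tail-split (cong (λ t → inner + t) last)) ⟩
        (h x + (inner + sign p * 1ℤ * H)) - (h x - H)
          ≡⟨ collect (h x) inner (sign p) H ⟩
        inner + (sign p + 1ℤ) * H
          ∎
        where collect : ∀ u m s H → (u + (m + s * 1ℤ * H)) - (u - H) ≡ m + (s + 1ℤ) * H
              collect = solve-∀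
      inner-divisible : (+ p) ∣ inner
      inner-divisible = sumBelow-divisible q _ λ i i<q →
        ∣m⇒∣m*n (h (x ⊖ suc i · a)) (∣n⇒∣m*n (sign (suc i))
          (∣ᵤ⇒∣ (prime∣binomial isPrime (suc i) (s≤s z≤n) (subst (suc i <_) q+1≡p (s≤s i<q)))))
      divisible : (+ p) ∣ (inner + (sign p + 1ℤ) * H)
      divisible = ∣m∣n⇒∣m+n inner-divisible (∣m⇒∣m*n H (prime∣sign+1 isPrime))

  frobenius : Prime p → ∀ a h → Δ^ p a h ≡ₚ Δ (p · a) h
  frobenius isPrime a h = congruent (frobenius-at isPrime a h)

  frobenius-multiple : Prime p → ∀ N a h → Δ^ (N ℕ.* p) a h ≡ₚ Δ^ N (p · a) h
  frobenius-multiple isPrime zero    a h = ≗⇒≡ₚ (λ _ → refl)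
  frobenius-multiple isPrime (suc N) a h =
    ≡ₚ-trans
      (≡ₚ-trans
        (≗⇒≡ₚ (Δ^-+ p (N ℕ.* p) a h))
        (Δ^-≡ₚ p a (frobenius-multiple isPrime N a h)))
      (frobenius isPrime a (Δ^ N (p · a) h))

  frobenius-power : Prime p → ∀ m a h → Δ^ (p ℕ.^ m) a h ≡ₚ Δ (p ℕ.^ m · a) h
  frobenius-power isPrime zero    a h = ≗⇒≡ₚ (λ x → cong (λ y → h x - h (x ⊖ y)) (sym (1· a)))
  frobenius-power isPrime (suc m) a h =
    ≡ₚ-trans
      (subst (λ k → Δ^ k a h ≡ₚ Δ^ (p ℕ.^ m) (p · a) h) (ℕ.*-comm (p ℕ.^ m) p)
             (frobenius-multiple isPrime (p ℕ.^ m) a h))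
      (≡ₚ-trans
        (frobenius-power isPrime m (p · a) h)
        (≗⇒≡ₚ (λ x → cong (λ y → h x - h (x ⊖ y))
                         (trans (·-· (p ℕ.^ m) p a) (cong (_· a) (ℕ.*-comm (p ℕ.^ m) p))))))

module Directions where
  open import Data.Nat using (zero; suc; _+_; _≤_; z≤n; s≤s)
  open import Data.Nat.Properties using (+-0-commutativeMonoid; +-mono-≤; +-identityʳ; ≤-trans; m≤n+m)
  open import Algebra.Properties.CommutativeMonoid.Sum +-0-commutativeMonoid
    using (sum; ∑-distrib-+; sum-replicate-zero)
  open import Data.Bool using (if_then_else_)
  open import Data.Fin using (zero; suc)
  open import Data.Fin.Properties using (_≟_)
  open import Data.List using (List; []; _∷_; _++_; replicate; map; length)
  open import Function using (_∘_)
  open import Relation.Nullary using (does; yes; no)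
  open import Data.Empty using (⊥-elim)
  open import Data.List.Membership.Propositional using (_∈_)
  open import Data.List.Relation.Unary.Any using (here; there)
  open import Relation.Binary.PropositionalEquality using (refl; sym; trans; cong; cong₂; subst)

  indicator : ∀ {n} → Fin n → Fin n → ℕ
  indicator k j = if does (k ≟ j) then 1 else 0

  count : ∀ {n} → Fin n → List (Fin n) → ℕ
  count j []      = 0
  count j (k ∷ L) = indicator k j + count j L

  indicator-self : ∀ {n} (k : Fin n) → indicator k k ≡ 1
  indicator-self k with k ≟ k
  ... | yes _  = refl
  ... | no k≢k = ⊥-elim (k≢k refl)

  count-∈ : ∀ {n} {k : Fin n} {L} → k ∈ L → 1 ≤ count k L
  count-∈ {k = k} {_ ∷ L} (here refl) = subst (λ c → 1 ≤ c + count k L) (sym (indicator-self k)) (s≤s z≤n)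
  count-∈ {k = k} (there k∈L) = ≤-trans (count-∈ k∈L) (m≤n+m _ _)

  sum-indicator : ∀ {n} (k : Fin n) → sum (indicator k) ≡ 1
  sum-indicator {suc n} zero    = cong suc (sum-replicate-zero n)
  sum-indicator {suc n} (suc k) = sum-indicator k

  length-count : ∀ {n} (L : List (Fin n)) → length L ≡ sum (λ j → count j L)
  length-count {n} []    = sym (sum-replicate-zero n)
  length-count (k ∷ L) = sym (trans (∑-distrib-+ (indicator k) (λ j → count j L))
                                    (cong₂ _+_ (sum-indicator k) (sym (length-count L))))

  sum-mono : ∀ {n} {f g : Fin n → ℕ} → (∀ k → f k ≤ g k) → sum f ≤ sum g
  sum-mono {zero}  f≤g = z≤n
  sum-mono {suc n} f≤g = +-mono-≤ (f≤g zero) (sum-mono (f≤g ∘ suc))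

  build : ∀ {n} → (Fin n → ℕ) → List (Fin n)
  build {zero}  c = []
  build {suc n} c = replicate (c zero) zero ++ map suc (build (c ∘ suc))

  count-zeros-here : ∀ {n} m (L : List (Fin (suc n))) → count zero (replicate m zero ++ L) ≡ m + count zero L
  count-zeros-here zero    L = refl
  count-zeros-here (suc m) L = cong suc (count-zeros-here m L)

  count-zeros-there : ∀ {n} (k : Fin n) m L → count (suc k) (replicate m zero ++ L) ≡ count (suc k) L
  count-zeros-there k zero    L = refl
  count-zeros-there k (suc m) L = count-zeros-there k m L

  count-shifted-zero : ∀ {n} (L : List (Fin n)) → count zero (map suc L) ≡ 0
  count-shifted-zero []      = refl
  count-shifted-zero (k ∷ L) = count-shifted-zero L

  count-shifted : ∀ {n} (j : Fin n) L → count (suc j) (map suc L) ≡ count j L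
  count-shifted j []      = refl
  count-shifted j (k ∷ L) = cong (indicator k j +_) (count-shifted j L)

  count-build : ∀ {n} (c : Fin n → ℕ) j → count j (build c) ≡ c j
  count-build {suc n} c zero    =
    trans (count-zeros-here (c zero) _)
          (trans (cong (c zero +_) (count-shifted-zero (build (c ∘ suc)))) (+-identityʳ (c zero)))
  count-build {suc n} c (suc j) =
    trans (count-zeros-there j (c zero) _)
          (trans (count-shifted j (build (c ∘ suc))) (count-build (c ∘ suc) j))

-- Olson's argument for G = ⊕_k ℤ/M_k with every M_k a power of the prime p,
-- phrased for functions on ℤⁿ.  A function h is "killed from s on" if every
-- product of at least s basis differences Δ_{e_k} maps it to 0 mod p.  Every
-- M-periodic function is killed from D* = 1 + Σ_k (M_k - 1) on (pigeonhole
-- plus Frobenius), and each further difference Δ_g lowers the threshold by 1.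
module Olson (p : ℕ) (isPrime : Prime p) {n : ℕ} (M : Fin n → ℕ) (M-pow : ∀ k → ∃[ m ] M k ≡ p ^ m) where
  open import Data.Nat as ℕ using (suc; _∸_; _≤_; _<_; s≤s)
  import Data.Nat.Properties as ℕ
  open import Data.Nat.Properties using (+-0-commutativeMonoid)
  open import Algebra.Properties.CommutativeMonoid.Sum +-0-commutativeMonoid using (sum)
  open import Data.Integer using (ℤ; +_; _+_; _-_; 0ℤ)
  import Data.Integer.Properties as ℤ
  open import Data.Integer.Divisibility.Signed using (_∣_; divides; ∣m∣n⇒∣m+n)
  open import Data.Integer.Tactic.RingSolver using (solve-∀)
  open import Data.Fin.Properties using (_≟_; ¬∀⟶∃¬)
  open import Data.List using (List; []; _∷_; _++_; [_]; length)
  import Data.List.Properties as List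
  open import Data.Vec using (Vec; lookup; tabulate)
  import Data.Vec.Properties as Vec
  open import Data.Product using (_,_)
  open import Relation.Nullary using (¬_; yes; no)
  open import Relation.Binary.PropositionalEquality
    using (_≗_; refl; sym; trans; cong; cong₂; subst)
  open Points
  open Differences p {n}
  open Directions

  basis : Fin n → Vec ℤ n
  basis k = tabulate (λ j → + indicator k j)

  basisSum : List (Fin n) → Vec ℤ n
  basisSum []      = origin
  basisSum (k ∷ L) = basis k ⊕ basisSum L

  natural : (Fin n → ℕ) → Vec ℤ n
  natural c = tabulate (λ j → + c j)

  lookup-basisSum : ∀ L j → lookup (basisSum L) j ≡ + count j L
  lookup-basisSum []      j = Vec.lookup-replicate j 0ℤ
  lookup-basisSum (k ∷ L) j = trans (Vec.lookup-zipWith _+_ j (basis k) (basisSum L))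
    (trans (cong₂ _+_ (Vec.lookup∘tabulate _ j) (lookup-basisSum L j))
           (sym (ℤ.pos-+ (indicator k j) (count j L))))

  natural-basisSum : ∀ c → basisSum (build c) ≡ natural c
  natural-basisSum c = trans (sym (Vec.tabulate∘lookup (basisSum (build c))))
    (Vec.tabulate-cong (λ j → trans (lookup-basisSum (build c) j) (cong +_ (count-build c j))))

  Periodic : Fn → Set
  Periodic h = ∀ k x → h (x ⊖ M k · basis k) ≡ h x

  Δ* : List (Fin n) → Fn → Fn
  Δ* []      h = h
  Δ* (k ∷ L) h = Δ (basis k) (Δ* L h)

  Δ*-cong : ∀ L {h h'} → h ≗ h' → Δ* L h ≗ Δ* L h'
  Δ*-cong []      h≗h' = h≗h'
  Δ*-cong (k ∷ L) h≗h' = Δ-cong (basis k) (Δ*-cong L h≗h')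

  Δ*-comm : ∀ L a h → Δ a (Δ* L h) ≗ Δ* L (Δ a h)
  Δ*-comm []      a h x = refl
  Δ*-comm (k ∷ L) a h x = trans (Δ-comm a (basis k) (Δ* L h) x) (Δ-cong (basis k) (Δ*-comm L a h) x)

  Δ*-snoc : ∀ L k h → Δ* (L ++ [ k ]) h ≗ Δ* L (Δ (basis k) h)
  Δ*-snoc []       k h x = refl
  Δ*-snoc (k' ∷ L) k h   = Δ-cong (basis k') (Δ*-snoc L k h)

  Δ*-translate : ∀ L a h → Δ* L (λ x → h (x ⊖ a)) ≗ (λ x → Δ* L h (x ⊖ a))
  Δ*-translate []      a h x = refl
  Δ*-translate (k ∷ L) a h x =
    trans (Δ-cong (basis k) (Δ*-translate L a h) x)
          (cong (λ y → Δ* L h (x ⊖ a) - Δ* L h y) (⊖-comm x (basis k) a))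

  Δ*-+ : ∀ L h h' → Δ* L (λ x → h x + h' x) ≗ (λ x → Δ* L h x + Δ* L h' x)
  Δ*-+ []      h h' x = refl
  Δ*-+ (k ∷ L) h h' x =
    trans (Δ-cong (basis k) (Δ*-+ L h h') x)
          (interchange (Δ* L h x) (Δ* L h' x) (Δ* L h (x ⊖ basis k)) (Δ* L h' (x ⊖ basis k)))
    where interchange : ∀ u v w z → (u + v) - (w + z) ≡ (u - w) + (v - z)
          interchange = solve-∀

  -- Δ_{e_k}^{M_k} kills periodic functions: it is Δ_{M_k e_k} modulo p.
  period-kills : ∀ {h} → Periodic h → ∀ k → Vanishes (Δ^ (M k) (basis k) h)
  period-kills {h} per k with M-pow k
  ... | m , Mk≡pᵐ = subst (λ N → Vanishes (Δ^ N (basis k) h)) (sym Mk≡pᵐ)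
    (≡ₚ-vanishes (frobenius-power isPrime m (basis k) h) λ x →
      divides 0ℤ (trans (cong (λ N → h x - h (x ⊖ N · basis k)) (sym Mk≡pᵐ))
                 (trans (cong (h x -_) (per k x)) (trans (ℤ.+-inverseʳ (h x)) (sym (ℤ.*-zeroˡ (+ p)))))))

  enough-copies-kill : ∀ {h} → Periodic h → ∀ k L j → M k ≤ count k L ℕ.+ j → Vanishes (Δ* L (Δ^ j (basis k) h))
  enough-copies-kill {h} per k [] j Mk≤j =
    subst (λ N → Vanishes (Δ^ N (basis k) h)) (ℕ.m∸n+n≡m Mk≤j)
      (λ x → subst ((+ p) ∣_) (sym (Δ^-+ (j ∸ M k) (M k) (basis k) h x))
                   (Δ^-vanishes (j ∸ M k) (basis k) (period-kills per k) x))
  enough-copies-kill {h} per k (k' ∷ L) j Mk≤ with k' ≟ k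
  ... | yes refl = λ x → subst ((+ p) ∣_) (sym (Δ*-comm L (basis k) (Δ^ j (basis k) h) x))
      (enough-copies-kill per k L (suc j)
        (subst (M k ≤_) (sym (ℕ.+-suc (count k L) j)) Mk≤) x)
  ... | no k'≢k = Δ-vanishes (basis k')
      (enough-copies-kill per k L j Mk≤)

  -- D*(G) = 1 + Σ_k (M_k - 1), the lower bound for the Davenport constant
  D* : ℕ
  D* = suc (sum (λ k → M k ∸ 1))

  pigeonhole : ∀ L → D* ≤ length L → ∃[ k ] M k ≤ count k L
  pigeonhole L D*≤ with ¬∀⟶∃¬ n (λ k → count k L < M k) (λ k → count k L ℕ.<? M k) all-below
    where
      all-below : ¬ (∀ k → count k L < M k)
      all-below below = ℕ.<⇒≱ D*≤ (subst (_≤ sum (λ k → M k ∸ 1)) (sym (length-count L))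
        (sum-mono (λ k → subst (count k L ≤_) (ℕ.pred[m∸n]≡m∸[1+n] (M k) 0) (ℕ.<⇒≤pred (below k)))))
  ... | k , not-below = k , ℕ.≮⇒≥ not-below

  Killed : ℕ → Fn → Set
  Killed s h = ∀ L → s ≤ length L → Vanishes (Δ* L h)

  periodic-killed : ∀ {h} → Periodic h → Killed D* h
  periodic-killed per L D*≤ with pigeonhole L D*≤
  ... | k , Mk≤ = enough-copies-kill per k L 0 (subst (M k ≤_) (sym (ℕ.+-identityʳ _)) Mk≤)

  Killed-weaken : ∀ {s s' h} → s ≤ s' → Killed s h → Killed s' h
  Killed-weaken s≤s' killed L s'≤ = killed L (ℕ.≤-trans s≤s' s'≤)

  Killed-≗ : ∀ {s h h'} → h ≗ h' → Killed s h → Killed s h'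
  Killed-≗ h≗h' killed L s≤ x = subst ((+ p) ∣_) (Δ*-cong L h≗h' x) (killed L s≤ x)

  Killed-+ : ∀ {s h h'} → Killed s h → Killed s h' → Killed s (λ x → h x + h' x)
  Killed-+ {h = h} {h'} killed killed' L s≤ x =
    subst ((+ p) ∣_) (sym (Δ*-+ L h h' x)) (∣m∣n⇒∣m+n (killed L s≤ x) (killed' L s≤ x))

  Killed-zero : ∀ {s} → Killed s (λ _ → 0ℤ)
  Killed-zero L _ x = subst ((+ p) ∣_) (sym (Δ*-zero L x)) (divides 0ℤ refl)
    where
      Δ*-zero : ∀ L → Δ* L (λ _ → 0ℤ) ≗ (λ _ → 0ℤ)
      Δ*-zero []      x = refl
      Δ*-zero (k ∷ L) x = cong₂ _-_ (Δ*-zero L x) (Δ*-zero L (x ⊖ basis k))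

  Killed-translate : ∀ {s h} a → Killed s h → Killed s (λ x → h (x ⊖ a))
  Killed-translate {h = h} a killed L s≤ x =
    subst ((+ p) ∣_) (sym (Δ*-translate L a h x)) (killed L s≤ (x ⊖ a))

  Killed-Δbasis : ∀ {s h} k → Killed (suc s) h → Killed s (Δ (basis k) h)
  Killed-Δbasis {s} {h} k killed L s≤ x =
    subst ((+ p) ∣_) (Δ*-snoc L k h x)
      (killed (L ++ [ k ]) (subst (suc s ≤_) (sym (trans (List.length-++ L) (ℕ.+-comm (length L) 1))) (s≤s s≤)) x)

  Δ-⊕ : ∀ a b h → (λ x → Δ a h x + Δ b h (x ⊖ a)) ≗ Δ (a ⊕ b) h
  Δ-⊕ a b h x = trans (telescope (h x) (h (x ⊖ a)) (h (x ⊖ a ⊖ b))) (cong (λ y → h x - h y) (⊖-⊕ x a b))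
    where telescope : ∀ u v w → (u - v) + (v - w) ≡ u - w
          telescope = solve-∀

  Killed-ΔbasisSum : ∀ {s h} L → Killed (suc s) h → Killed s (Δ (basisSum L) h)
  Killed-ΔbasisSum {h = h} []      killed =
    Killed-≗ (λ x → sym (trans (cong (λ y → h x - h y) (⊖-origin x)) (ℤ.+-inverseʳ (h x)))) Killed-zero
  Killed-ΔbasisSum {h = h} (k ∷ L) killed =
    Killed-≗ (Δ-⊕ (basis k) (basisSum L) h)
      (Killed-+ (Killed-Δbasis k killed) (Killed-translate (basis k) (Killed-ΔbasisSum L killed)))

  Killed-Δ : ∀ {s h} c → Killed (suc s) h → Killed s (Δ (natural c) h)
  Killed-Δ {h = h} c killed =
    Killed-≗ (λ x → cong (λ g → h x - h (x ⊖ g)) (natural-basisSum c)) (Killed-ΔbasisSum (build c) killed)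

-- Sums over all subsequences (sublists) U of a list T of a weight ψ U w,
-- where w = |T| - |U| is the number of omitted terms.
module SubsequenceSums where
  open import Data.Nat as ℕ using (suc; _≤_; s≤s; z≤n)
  import Data.Nat.Properties as ℕ
  open import Data.Integer using (ℤ; -_; _+_; 0ℤ)
  import Data.Integer.Properties as ℤ
  open import Data.Integer.Tactic.RingSolver using (solve-∀)
  open import Data.List using (List; []; _∷_; length)
  open import Data.List.Relation.Binary.Sublist.Propositional using (_⊆_; []; _∷_; _∷ʳ_)
  open import Relation.Binary.PropositionalEquality using (refl; trans; cong; cong₂)

  sumSublists : ∀ {A : Set} → List A → (List A → ℕ → ℤ) → ℤ
  sumSublists []      ψ = ψ [] 0
  sumSublists (g ∷ T) ψ = sumSublists T (λ U w → ψ (g ∷ U) w) + sumSublists T (λ U w → ψ U (suc w))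

  sumSublists-cong : ∀ {A : Set} (T : List A) {ψ χ} → (∀ U w → ψ U w ≡ χ U w) → sumSublists T ψ ≡ sumSublists T χ
  sumSublists-cong []      ψ≡χ = ψ≡χ [] 0
  sumSublists-cong (g ∷ T) ψ≡χ =
    cong₂ _+_ (sumSublists-cong T (λ U w → ψ≡χ (g ∷ U) w)) (sumSublists-cong T (λ U w → ψ≡χ U (suc w)))

  sumSublists-+ : ∀ {A : Set} (T : List A) ψ χ →
    sumSublists T ψ + sumSublists T χ ≡ sumSublists T (λ U w → ψ U w + χ U w)
  sumSublists-+ []      ψ χ = refl
  sumSublists-+ (g ∷ T) ψ χ =
    trans (interchange (sumSublists T (λ U w → ψ (g ∷ U) w)) (sumSublists T (λ U w → ψ U (suc w)))
                       (sumSublists T (λ U w → χ (g ∷ U) w)) (sumSublists T (λ U w → χ U (suc w))))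
          (cong₂ _+_ (sumSublists-+ T _ _) (sumSublists-+ T _ _))
    where interchange : ∀ a a' b b' → (a + a') + (b + b') ≡ (a + b) + (a' + b')
          interchange = solve-∀

  sumSublists-neg : ∀ {A : Set} (T : List A) ψ → - sumSublists T ψ ≡ sumSublists T (λ U w → - ψ U w)
  sumSublists-neg []      ψ = refl
  sumSublists-neg (g ∷ T) ψ =
    trans (ℤ.neg-distrib-+ (sumSublists T (λ U w → ψ (g ∷ U) w)) (sumSublists T (λ U w → ψ U (suc w))))
          (cong₂ _+_ (sumSublists-neg T _) (sumSublists-neg T _))

  sumSublists-zero : ∀ {A : Set} (T : List A) ψ →
    (∀ U w → U ⊆ T → ℕ._+_ (length U) w ≡ length T → ψ U w ≡ 0ℤ) → sumSublists T ψ ≡ 0ℤ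
  sumSublists-zero []      ψ null = null [] 0 [] refl
  sumSublists-zero (g ∷ T) ψ null = cong₂ _+_
    (sumSublists-zero T _ (λ U w U⊆T len → null (g ∷ U) w (refl ∷ U⊆T) (cong suc len)))
    (sumSublists-zero T _ (λ U w U⊆T len → null U (suc w) (g ∷ʳ U⊆T) (trans (ℕ.+-suc (length U) w) (cong suc len))))

  sumSublists-empty : ∀ {A : Set} (T : List A) ψ →
    (∀ U w → U ⊆ T → ℕ._+_ (length U) w ≡ length T → 1 ≤ length U → ψ U w ≡ 0ℤ) →
    sumSublists T ψ ≡ ψ [] (length T)
  sumSublists-empty []      ψ null = refl
  sumSublists-empty (g ∷ T) ψ null = trans (cong₂ _+_
    (sumSublists-zero T _ (λ U w U⊆T len → null (g ∷ U) w (refl ∷ U⊆T) (cong suc len) (s≤s z≤n)))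
    (sumSublists-empty T _ (λ U w U⊆T len → null U (suc w) (g ∷ʳ U⊆T) (trans (ℕ.+-suc (length U) w) (cong suc len)))))
    (ℤ.+-identityˡ _)

module PolynomialWeights where
  open import Data.Nat as ℕ using (zero; suc; _≤_; _<_; s≤s; z≤n; nonTrivial⇒n>1)
  import Data.Nat.Properties as ℕ
  import Data.Nat.Divisibility as ℕ
  open import Data.Nat.Primality using (euclidsLemma; prime⇒nonTrivial; prime⇒nonZero)
  open import Data.Integer using (ℤ; +_; _+_; _-_; _*_; 0ℤ; 1ℤ; ∣_∣)
  import Data.Integer.Properties as ℤ
  open import Data.Integer.Divisibility.Signed using (_∣_; ∣⇒∣ᵤ)
  open import Data.Integer.Tactic.RingSolver using (solve-∀)
  open import Data.Sum using (inj₁; inj₂)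
  open import Data.Empty using (⊥-elim)
  open import Relation.Nullary using (¬_; yes; no)
  open import Relation.Binary.PropositionalEquality using (refl; sym; trans; cong; cong₂; subst)

  ∇ : (ℕ → ℤ) → ℕ → ℤ
  ∇ φ w = φ (suc w) - φ w

  Degree≤ : (ℕ → ℤ) → ℕ → Set
  Degree≤ φ zero    = ∀ w → ∇ φ w ≡ 0ℤ
  Degree≤ φ (suc b) = Degree≤ (∇ φ) b

  Degree≤-cong : ∀ b {φ χ} → (∀ w → φ w ≡ χ w) → Degree≤ φ b → Degree≤ χ b
  Degree≤-cong zero    φ≡χ deg w = trans (sym (cong₂ _-_ (φ≡χ (suc w)) (φ≡χ w))) (deg w)
  Degree≤-cong (suc b) φ≡χ deg = Degree≤-cong b (λ w → cong₂ _-_ (φ≡χ (suc w)) (φ≡χ w)) deg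

  Degree≤-zero : ∀ b {φ} → (∀ w → φ w ≡ 0ℤ) → Degree≤ φ b
  Degree≤-zero zero    φ≡0 w = cong₂ _-_ (φ≡0 (suc w)) (φ≡0 w)
  Degree≤-zero (suc b) φ≡0 = Degree≤-zero b (λ w → cong₂ _-_ (φ≡0 (suc w)) (φ≡0 w))

  interchange : ∀ u v w z → (u + v) - (w + z) ≡ (u - w) + (v - z)
  interchange = solve-∀

  Degree≤-+ : ∀ b {φ χ} → Degree≤ φ b → Degree≤ χ b → Degree≤ (λ w → φ w + χ w) b
  Degree≤-+ zero    {φ} {χ} deg deg' w =
    trans (interchange (φ (suc w)) (χ (suc w)) (φ w) (χ w)) (cong₂ _+_ (deg w) (deg' w))
  Degree≤-+ (suc b) {φ} {χ} deg deg' =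
    Degree≤-cong b (λ w → sym (interchange (φ (suc w)) (χ (suc w)) (φ w) (χ w))) (Degree≤-+ b deg deg')

  Degree≤-shift : ∀ b {φ} → Degree≤ φ b → Degree≤ (λ w → φ (suc w)) b
  Degree≤-shift zero    deg w = deg (suc w)
  Degree≤-shift (suc b) deg   = Degree≤-shift b deg

  -- multiplying by a linear factor raises the degree by one, because
  -- ∇((w-d)ψ)(w) = ψ(w+1) + (w-d)·∇ψ(w)
  Degree≤-linear : ∀ b d {ψ} → Degree≤ ψ b → Degree≤ (λ w → (+ w - + d) * ψ w) (suc b)
  Degree≤-linear b d {ψ} deg =
    Degree≤-cong b (λ w → sym (product-rule (+ w) (+ d) (ψ (suc w)) (ψ w)))
                 (Degree≤-+ b (Degree≤-shift b deg) (times-difference b deg))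
    where
      product-rule : ∀ w d u v → (1ℤ + w - d) * u - (w - d) * v ≡ u + (w - d) * (u - v)
      product-rule = solve-∀
      times-difference : ∀ b {ψ} → Degree≤ ψ b → Degree≤ (λ w → (+ w - + d) * ∇ ψ w) b
      times-difference zero    deg = Degree≤-zero zero (λ w → trans (cong ((+ w - + d) *_) (deg w)) (ℤ.*-zeroʳ (+ w - + d)))
      times-difference (suc b) deg = Degree≤-linear b d deg

  fallingProduct : ℕ → ℕ → ℕ → ℤ
  fallingProduct c zero    w = 1ℤ
  fallingProduct c (suc m) w = (+ w - + (c ℕ.+ m)) * fallingProduct c m w

  fallingProduct-degree : ∀ c m → Degree≤ (fallingProduct c m) m
  fallingProduct-degree c zero    w = ℤ.+-inverseʳ 1ℤ
  fallingProduct-degree c (suc m) = Degree≤-linear m (c ℕ.+ m) (fallingProduct-degree c m)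

  fallingProduct-root : ∀ c m w → c ≤ w → w < c ℕ.+ m → fallingProduct c m w ≡ 0ℤ
  fallingProduct-root c zero    w c≤w w<c = ⊥-elim (ℕ.<⇒≱ w<c (subst (_≤ w) (sym (ℕ.+-identityʳ c)) c≤w))
  fallingProduct-root c (suc m) w c≤w w<c+m+1 with w ℕ.≟ c ℕ.+ m
  ... | yes refl = trans (cong (_* fallingProduct c m (c ℕ.+ m)) (ℤ.+-inverseʳ (+ (c ℕ.+ m))))
                         (ℤ.*-zeroˡ (fallingProduct c m (c ℕ.+ m)))
  ... | no w≢ = trans (cong ((+ w - + (c ℕ.+ m)) *_) (fallingProduct-root c m w c≤w w<c+m))
                      (ℤ.*-zeroʳ (+ w - + (c ℕ.+ m)))
    where w<c+m = ℕ.≤∧≢⇒< (ℕ.≤-pred (subst (suc w ≤_) (ℕ.+-suc c m) w<c+m+1)) w≢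

  prime∤ : ∀ {p a} → 0 < a → a < p → ¬ p ℕ.∣ a
  prime∤ {a = suc a} _ a<p p∣a = ℕ.<⇒≱ a<p (ℕ.∣⇒≤ p∣a)

  -- for c+m ≤ w < c+p every factor w-(c+k), k < m, lies strictly between 0 and p
  fallingProduct-unit : ∀ {p} → Prime p → ∀ c m w → c ℕ.+ m ≤ w → w < c ℕ.+ p → ¬ (+ p) ∣ fallingProduct c m w
  fallingProduct-unit {p} isPrime c m w c+m≤w w<c+p p∣product = unit m c+m≤w (∣⇒∣ᵤ p∣product)
    where
      instance _ = prime⇒nonZero isPrime
      unit : ∀ m → c ℕ.+ m ≤ w → ¬ p ℕ.∣ ∣ fallingProduct c m w ∣
      unit zero    _     = prime∤ (s≤s z≤n) (nonTrivial⇒n>1 p ⦃ prime⇒nonTrivial isPrime ⦄)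
      unit (suc m) c+m<w p∣product
        with euclidsLemma ∣ + w - + (c ℕ.+ m) ∣ ∣ fallingProduct c m w ∣ isPrime
               (subst (p ℕ.∣_) (ℤ.abs-* (+ w - + (c ℕ.+ m)) (fallingProduct c m w)) p∣product)
      ... | inj₂ p∣rest   = unit m (ℕ.≤-trans (ℕ.+-monoʳ-≤ c (ℕ.n≤1+n m)) c+m<w) p∣rest
      ... | inj₁ p∣factor = prime∤ (ℕ.m<n⇒0<n∸m c+m<w′) factor<p (subst (p ℕ.∣_) factor≡ p∣factor)
        where
          c+m<w′ : c ℕ.+ m < w
          c+m<w′ = subst (_≤ w) (ℕ.+-suc c m) c+m<w
          factor≡ : ∣ + w - + (c ℕ.+ m) ∣ ≡ w ℕ.∸ (c ℕ.+ m)
          factor≡ = cong ∣_∣ (trans (ℤ.m-n≡m⊖n w (c ℕ.+ m)) (ℤ.⊖-≥ (ℕ.<⇒≤ c+m<w′)))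
          factor<p : w ℕ.∸ (c ℕ.+ m) < p
          factor<p = ℕ.≤-<-trans (ℕ.∸-monoʳ-≤ w (ℕ.m≤m+n c m)) (ℕ.m<n+o⇒m∸n<o w c w<c+p)

-- The weighted subsequence sum
--   F_φ(T)(x) = Σ_{U ⊆ T} (-1)^{|U|} φ(|T|-|U|) [x - σ(U) ∈ ⊕ M_k ℤ]
-- satisfies F_φ(g∷T) = Δ_g F_φ(T) + F_{∇φ}(T), hence is killed from
-- D* + deg φ - |T| on; at the origin it counts the zero-sum subsequences.
module LongZeroSums (p : ℕ) (isPrime : Prime p) {n : ℕ} (M : Fin n → ℕ) (M-pow : ∀ k → ∃[ m ] M k ≡ p ^ m)
                    {A : Set} (coords : A → Fin n → ℕ) where
  open import Data.Nat as ℕ using (zero; suc; _≤_; _<_; z≤n)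
  import Data.Nat.Properties as ℕ
  import Data.Nat.Divisibility as ℕ
  open import Data.Integer using (ℤ; +_; -_; _+_; _-_; _*_; 0ℤ; 1ℤ)
  import Data.Integer.Properties as ℤ
  open import Data.Integer.Divisibility.Signed
    using (_∣_; _∣?_; divides; ∣-refl; ∣m∣n⇒∣m+n; ∣m∣n⇒∣m-n; ∣m⇒∣m*n; ∣m⇒∣-m; ∣⇒∣ᵤ; ∣ᵤ⇒∣)
  open import Data.Integer.Tactic.RingSolver using (solve-∀)
  open import Data.Fin.Properties using (_≟_; all?)
  open import Data.List using (List; []; _∷_; length)
  open import Data.List.Relation.Binary.Sublist.Propositional using (_⊆_)
  open import Data.Vec using (Vec; lookup)
  import Data.Vec.Properties as Vec
  open import Data.Product using (_×_; _,_)
  open import Data.Empty using (⊥; ⊥-elim)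
  open import Relation.Nullary using (¬_; Dec; yes; no)
  open import Relation.Binary.PropositionalEquality
    using (_≗_; refl; sym; trans; cong; cong₂; subst; subst₂; module ≡-Reasoning)
  open Points
  open Differences p {n}
  open Olson p isPrime M M-pow
  open IntegerSums using (sign)
  open SubsequenceSums
  open PolynomialWeights
  open Directions using (indicator)

  coordinateSum : Fin n → List A → ℕ
  coordinateSum k []      = 0
  coordinateSum k (g ∷ U) = coords g k ℕ.+ coordinateSum k U

  IsZeroSum : List A → Set
  IsZeroSum U = ∀ k → M k ℕ.∣ coordinateSum k U

  σ : List A → Vec ℤ n
  σ []      = origin
  σ (g ∷ U) = natural (coords g) ⊕ σ U

  lookup-σ : ∀ U k → lookup (σ U) k ≡ + coordinateSum k U
  lookup-σ []      k = Vec.lookup-replicate k 0ℤ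
  lookup-σ (g ∷ U) k = trans (Vec.lookup-zipWith _+_ k (natural (coords g)) (σ U))
    (trans (cong₂ _+_ (Vec.lookup∘tabulate _ k) (lookup-σ U k)) (sym (ℤ.pos-+ (coords g k) (coordinateSum k U))))

  InLattice : Vec ℤ n → Set
  InLattice x = ∀ k → (+ M k) ∣ lookup x k

  inLattice? : ∀ x → Dec (InLattice x)
  inLattice? x = all? (λ k → (+ M k) ∣? lookup x k)

  characteristic : ∀ {P : Set} → Dec P → ℤ
  characteristic (yes _) = 1ℤ
  characteristic (no _)  = 0ℤ

  δ : Vec ℤ n → ℤ
  δ x = characteristic (inLattice? x)

  δ-in : ∀ x → InLattice x → δ x ≡ 1ℤ
  δ-in x in-x with inLattice? x
  ... | yes _     = refl
  ... | no ¬in-x  = ⊥-elim (¬in-x in-x)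

  δ-out : ∀ x → ¬ InLattice x → δ x ≡ 0ℤ
  δ-out x ¬in-x with inLattice? x
  ... | yes in-x = ⊥-elim (¬in-x in-x)
  ... | no _     = refl

  δ-cong : ∀ x y → (InLattice x → InLattice y) → (InLattice y → InLattice x) → δ x ≡ δ y
  δ-cong x y x⇒y y⇒x with inLattice? x
  ... | yes in-x  = sym (δ-in y (x⇒y in-x))
  ... | no ¬in-x  = sym (δ-out y (λ in-y → ¬in-x (y⇒x in-y)))

  δ-periodic : Periodic δ
  δ-periodic k x = sym (δ-cong x (x ⊖ M k · basis k)
    (λ in-x j → subst ((+ M j) ∣_) (sym (coordinate j)) (∣m∣n⇒∣m-n (in-x j) (step-divisible j)))
    (λ in-y j → subst ((+ M j) ∣_) (cancel (lookup x j) (step j))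
                      (∣m∣n⇒∣m+n (subst ((+ M j) ∣_) (coordinate j) (in-y j)) (step-divisible j))))
    where
      step : Fin n → ℤ
      step j = + M k * + indicator k j
      coordinate : ∀ j → lookup (x ⊖ M k · basis k) j ≡ lookup x j - step j
      coordinate j = trans (Vec.lookup-zipWith _-_ j x (M k · basis k))
        (cong (λ t → lookup x j - t) (trans (Vec.lookup-map j _ (basis k)) (cong (+ M k *_) (Vec.lookup∘tabulate _ j))))
      step-divisible : ∀ j → (+ M j) ∣ step j
      step-divisible j with k ≟ j
      ... | yes refl = ∣m⇒∣m*n (+ 1) ∣-refl
      ... | no _     = divides 0ℤ (trans (ℤ.*-zeroʳ (+ M k)) (sym (ℤ.*-zeroˡ (+ M j))))
      cancel : ∀ u v → u - v + v ≡ u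
      cancel = solve-∀

  lookup-negσ : ∀ U k → lookup (origin ⊖ σ U) k ≡ - + coordinateSum k U
  lookup-negσ U k = trans (Vec.lookup-zipWith _-_ k origin (σ U))
    (trans (cong₂ _-_ (Vec.lookup-replicate k 0ℤ) (lookup-σ U k)) (ℤ.+-identityˡ _))

  δ-zeroSum : ∀ U → IsZeroSum U → δ (origin ⊖ σ U) ≡ 1ℤ
  δ-zeroSum U zs = δ-in (origin ⊖ σ U) (λ k → subst ((+ M k) ∣_) (sym (lookup-negσ U k)) (∣m⇒∣-m (∣ᵤ⇒∣ (zs k))))

  δ-notZeroSum : ∀ U → ¬ IsZeroSum U → δ (origin ⊖ σ U) ≡ 0ℤ
  δ-notZeroSum U ¬zs = δ-out (origin ⊖ σ U) (λ in-U → ¬zs (λ k →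
    subst (M k ℕ.∣_) (ℤ.∣-i∣≡∣i∣ (+ coordinateSum k U)) (∣⇒∣ᵤ (subst ((+ M k) ∣_) (lookup-negσ U k) (in-U k)))))

  weightedSum : (ℕ → ℤ) → List A → Fn
  weightedSum φ T x = sumSublists T (λ U w → sign (length U) * φ w * δ (x ⊖ σ U))

  -- F_φ(g∷T) = Δ_g F_φ(T) + F_{∇φ}(T): split according to whether g ∈ U
  weightedSum-step : ∀ φ g T →
    (λ x → Δ (natural (coords g)) (weightedSum φ T) x + weightedSum (∇ φ) T x) ≗ weightedSum φ (g ∷ T)
  weightedSum-step φ g T x = begin
    (Σ ψ - Σ χ) + Σ ω
      ≡⟨ regroup (Σ ψ) (Σ χ) (Σ ω) ⟩
    - Σ χ + (Σ ψ + Σ ω)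
      ≡⟨ cong₂ _+_ (sumSublists-neg T χ) (sumSublists-+ T ψ ω) ⟩
    sumSublists T (λ U w → - χ U w) + sumSublists T (λ U w → ψ U w + ω U w)
      ≡⟨ cong₂ _+_ (sumSublists-cong T with-g) (sumSublists-cong T without-g) ⟩
    weightedSum φ (g ∷ T) x
      ∎
    where
      open ≡-Reasoning
      Σ = sumSublists T
      ψ χ ω : List A → ℕ → ℤ
      ψ U w = sign (length U) * φ w * δ (x ⊖ σ U)
      χ U w = sign (length U) * φ w * δ (x ⊖ natural (coords g) ⊖ σ U)
      ω U w = sign (length U) * ∇ φ w * δ (x ⊖ σ U)
      regroup : ∀ a b c → (a - b) + c ≡ - b + (a + c)
      regroup = solve-∀
      with-g : ∀ U w → - χ U w ≡ sign (length (g ∷ U)) * φ w * δ (x ⊖ σ (g ∷ U))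
      with-g U w = trans (negate (sign (length U)) (φ w) _)
        (cong (λ y → - sign (length U) * φ w * δ y) (⊖-⊕ x (natural (coords g)) (σ U)))
        where negate : ∀ s f d → - (s * f * d) ≡ - s * f * d
              negate = solve-∀
      without-g : ∀ U w → ψ U w + ω U w ≡ sign (length U) * φ (suc w) * δ (x ⊖ σ U)
      without-g U w = telescope (sign (length U)) (φ w) (φ (suc w)) (δ (x ⊖ σ U))
        where telescope : ∀ s f f' d → s * f * d + s * (f' - f) * d ≡ s * f' * d
              telescope = solve-∀

  shift-bound : ∀ {a s t} → a ≤ s ℕ.+ suc t → a ≤ suc s ℕ.+ t
  shift-bound {a} {s} {t} = subst (a ≤_) (ℕ.+-suc s t)

  weightedSum-killed : ∀ T b φ → Degree≤ φ b → ∀ s → D* ℕ.+ b ≤ s ℕ.+ length T → Killed s (weightedSum φ T)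
  weightedSum-killed [] b φ deg s bound =
    Killed-weaken (ℕ.≤-trans (ℕ.m≤m+n D* b) (subst (D* ℕ.+ b ≤_) (ℕ.+-identityʳ s) bound))
                  (periodic-killed periodic)
    where
      periodic : Periodic (weightedSum φ [])
      periodic k x = cong (λ t → 1ℤ * φ 0 * t)
        (trans (cong δ (⊖-origin (x ⊖ M k · basis k))) (trans (δ-periodic k x) (cong δ (sym (⊖-origin x)))))
  weightedSum-killed (g ∷ T) zero φ deg s bound =
    Killed-≗ (weightedSum-step φ g T)
      (Killed-+ (Killed-Δ (coords g) (weightedSum-killed T zero φ deg (suc s) (shift-bound bound)))
                (Killed-≗ (λ x → sym (constant x)) Killed-zero))
    where
      constant : ∀ x → weightedSum (∇ φ) T x ≡ 0ℤ
      constant x = sumSublists-zero T _ λ U w _ _ →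
        trans (cong (λ t → sign (length U) * t * δ (x ⊖ σ U)) (deg w))
              (trans (cong (_* δ (x ⊖ σ U)) (ℤ.*-zeroʳ (sign (length U)))) (ℤ.*-zeroˡ (δ (x ⊖ σ U))))
  weightedSum-killed (g ∷ T) (suc b) φ deg s bound =
    Killed-≗ (weightedSum-step φ g T)
      (Killed-+ (Killed-Δ (coords g) (weightedSum-killed T (suc b) φ deg (suc s) (shift-bound bound)))
                (weightedSum-killed T b (∇ φ) deg s
                  (ℕ.≤-pred (subst₂ _≤_ (ℕ.+-suc D* b) (ℕ.+-suc s (length T)) bound))))

  isZeroSum? : ∀ U → Dec (IsZeroSum U)
  isZeroSum? U = all? (λ k → M k ℕ.∣? coordinateSum k U)

  -- At the origin a subsequence U contributes only if it is zero-sum; so if φ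
  -- vanishes at |T| - |U| for every non-empty zero-sum U, only U = [] remains.
  weightedSum-origin : ∀ φ T →
    (∀ U w → U ⊆ T → length U ℕ.+ w ≡ length T → 1 ≤ length U → IsZeroSum U → φ w ≡ 0ℤ) →
    weightedSum φ T origin ≡ φ (length T)
  weightedSum-origin φ T roots = trans (sumSublists-empty T _ silent) empty
    where
      silent : ∀ U w → U ⊆ T → length U ℕ.+ w ≡ length T → 1 ≤ length U →
               sign (length U) * φ w * δ (origin ⊖ σ U) ≡ 0ℤ
      silent U w U⊆T len nonempty with isZeroSum? U
      ... | yes zs = trans (cong (λ t → sign (length U) * t * δ (origin ⊖ σ U)) (roots U w U⊆T len nonempty zs))
                           (trans (cong (_* δ (origin ⊖ σ U)) (ℤ.*-zeroʳ (sign (length U)))) (ℤ.*-zeroˡ (δ (origin ⊖ σ U))))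
      ... | no ¬zs = trans (cong (sign (length U) * φ w *_) (δ-notZeroSum U ¬zs)) (ℤ.*-zeroʳ (sign (length U) * φ w))
      empty : 1ℤ * φ (length T) * δ (origin ⊖ origin) ≡ φ (length T)
      empty = trans (cong (1ℤ * φ (length T) *_) (δ-zeroSum [] (λ k → M k ℕ.∣0))) (unit (φ (length T)))
        where unit : ∀ a → 1ℤ * a * 1ℤ ≡ a
              unit = solve-∀

  root-window : ∀ c b {u w} → u ℕ.+ w ≡ c ℕ.+ suc b → 2 ≤ u → u ≤ suc b → c ≤ w × w < c ℕ.+ b
  root-window c b {u} {w} total 2≤u u≤b+1 = c≤w , w<c+b
    where
      open ℕ.≤-Reasoning
      c≤w : c ≤ w
      c≤w = ℕ.+-cancelʳ-≤ (suc b) c w (begin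
        c ℕ.+ suc b    ≡⟨ total ⟨
        u ℕ.+ w        ≤⟨ ℕ.+-monoˡ-≤ w u≤b+1 ⟩
        suc b ℕ.+ w    ≡⟨ ℕ.+-comm (suc b) w ⟩
        w ℕ.+ suc b    ∎)
      w<c+b : w < c ℕ.+ b
      w<c+b = ℕ.≤-pred (begin
        2 ℕ.+ w        ≤⟨ ℕ.+-monoˡ-≤ w 2≤u ⟩
        u ℕ.+ w        ≡⟨ total ⟩
        c ℕ.+ suc b    ≡⟨ ℕ.+-suc c b ⟩
        suc (c ℕ.+ b)  ∎)

  -- Let |T| = c + b + 1 with D* ≤ c + 1 and b + 1 < p.  Then not
  -- every non-empty zero-sum subsequence of T has length between 2 and b + 1:
  -- otherwise φ = Π_{m<b} (w - (c+m)) kills all such contributions, and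
  -- F_φ(T)(0) = φ(|T|) = (b+1)! would be divisible by p.
  no-medium-zero-sums : ∀ T c b → length T ≡ c ℕ.+ suc b → D* ≤ suc c → suc b < p →
    (∀ U → U ⊆ T → 1 ≤ length U → IsZeroSum U → 2 ≤ length U × length U ≤ suc b) → ⊥
  no-medium-zero-sums T c b len D*≤ b<p medium =
    fallingProduct-unit isPrime c b (length T) c+b≤T T<c+p
      (subst ((+ p) ∣_) (weightedSum-origin φ T roots) (killed [] z≤n origin))
    where
      open ℕ.≤-Reasoning
      φ = fallingProduct c b
      bound : D* ℕ.+ b ≤ length T
      bound = begin
        D* ℕ.+ b      ≤⟨ ℕ.+-monoˡ-≤ b D*≤ ⟩
        suc c ℕ.+ b   ≡⟨ ℕ.+-suc c b ⟨
        c ℕ.+ suc b   ≡⟨ len ⟨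
        length T      ∎
      killed : Killed 0 (weightedSum φ T)
      killed = weightedSum-killed T b φ (fallingProduct-degree c b) 0 bound
      c+b≤T : c ℕ.+ b ≤ length T
      c+b≤T = ℕ.≤-trans (ℕ.+-monoʳ-≤ c (ℕ.n≤1+n b)) (ℕ.≤-reflexive (sym len))
      T<c+p : length T < c ℕ.+ p
      T<c+p = subst (_< c ℕ.+ p) (sym len) (ℕ.+-monoʳ-< c b<p)
      roots : ∀ U w → U ⊆ T → length U ℕ.+ w ≡ length T → 1 ≤ length U → IsZeroSum U → φ w ≡ 0ℤ
      roots U w U⊆T total nonempty zs with medium U U⊆T nonempty zs
      ... | 2≤U , U≤b+1 = let c≤w , w<c+b = root-window c b (trans total len) 2≤U U≤b+1
                          in fallingProduct-root c b w c≤w w<c+b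

module Group (p : ℕ) (isPrime : Prime p) (r : ℕ) (e : Fin r → ℕ) where
  open import Data.Nat as ℕ using (zero; suc; _+_; _∸_; _≤_; _<_; z≤n; s≤s; NonZero)
  import Data.Nat.Properties as ℕ
  import Data.Nat.Divisibility as ℕ
  open import Data.Nat.DivMod using (_mod_; _%_; m%n≤m; m<n⇒m%n≡m)
  open import Data.Nat.Primality using (prime⇒nonZero)
  open import Data.Nat.Properties using (+-0-commutativeMonoid)
  open import Algebra.Properties.CommutativeMonoid.Sum +-0-commutativeMonoid using (sum; sum-cong-≗)
  open import Data.Fin as Fin using (toℕ)
  open import Data.Fin.Properties using (all?; toℕ-fromℕ<; toℕ<n)
  open import Data.List using (List; []; _∷_; _++_; map; length)
  import Data.List.Properties as List
  open import Data.List.Membership.Propositional.Properties using (∈-map⁻)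
  open import Data.List.Relation.Unary.All using (All; []; _∷_)
  open import Data.List.Relation.Unary.Any using (here)
  open import Data.List.Relation.Binary.Sublist.Propositional using (_⊆_; []; _∷_; _∷ʳ_; minimum)
  open import Data.List.Relation.Binary.Sublist.Propositional.Properties using (Any-resp-⊆; All-resp-⊆)
  open import Data.List.Relation.Binary.Permutation.Propositional using (_↭_; prep; ↭-sym; ↭-trans; ↭-refl)
  open import Data.List.Relation.Binary.Permutation.Propositional.Properties using (shift; ↭-length)
  open import Data.Product using (_×_; _,_; proj₁; proj₂)
  open import Data.Nat.Tactic.RingSolver using (solve-∀)
  open import Data.Empty using (⊥; ⊥-elim)
  open import Relation.Nullary using (¬_; Dec; yes; no)
  open import Relation.Binary.PropositionalEquality using (refl; sym; trans; cong; subst; subst₂)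
  open Directions

  M : Fin (suc r) → ℕ
  M = modulus p r e

  M-pow : ∀ k → ∃[ m ] M k ≡ p ^ m
  M-pow Fin.zero    = 1 , sym (ℕ.*-identityʳ p)
  M-pow (Fin.suc k) = e k , refl

  M-nonZero : ∀ k → NonZero (M k)
  M-nonZero Fin.zero    = prime⇒nonZero isPrime
  M-nonZero (Fin.suc k) = ℕ.m^n≢0 p (e k) ⦃ prime⇒nonZero isPrime ⦄

  open Olson p isPrime M M-pow using (D*)
  open LongZeroSums p isPrime M M-pow {Elem p r e} (λ g k → toℕ (g k)) public

  coordinateSum≡coordSum : ∀ k (S : Seq p r e) → coordinateSum k S ≡ coordSum k S
  coordinateSum≡coordSum k []      = refl
  coordinateSum≡coordSum k (g ∷ S) = cong (toℕ (g k) +_) (coordinateSum≡coordSum k S)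

  ⇒zeroSum : ∀ {S} → IsZeroSum S → ZeroSum S
  ⇒zeroSum {S} zs k = subst (M k ℕ.∣_) (coordinateSum≡coordSum k S) (zs k)

  unit : Fin (suc r) → Elem p r e
  unit k j = (indicator k j mod M j) ⦃ M-nonZero j ⦄

  unit-coordinate : ∀ k j → toℕ (unit k j) ≤ indicator k j
  unit-coordinate k j =
    subst (_≤ indicator k j) (sym (toℕ-fromℕ< _)) (m%n≤m (indicator k j) (M j) ⦃ M-nonZero j ⦄)

  unit-self : ∀ k → 1 < M k → toℕ (unit k k) ≡ 1
  unit-self k 1<M = trans (toℕ-fromℕ< _)
    (trans (cong (λ c → (c % M k) ⦃ M-nonZero k ⦄) (indicator-self k)) (m<n⇒m%n≡m ⦃ M-nonZero k ⦄ 1<M))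

  standard : Seq p r e
  standard = map unit (build (λ k → M k ∸ 1))

  standard-length : length standard ≡ sum (λ k → M k ∸ 1)
  standard-length = trans (List.length-map unit copies) (trans (length-count copies) (sum-cong-≗ (count-build (λ k → M k ∸ 1))))
    where copies = build (λ k → M k ∸ 1)

  coordSum-mono : ∀ {U V : Seq p r e} k → U ⊆ V → coordSum k U ≤ coordSum k V
  coordSum-mono k [] = z≤n
  coordSum-mono {V = g ∷ V} k (_ ∷ʳ U⊆V)    = ℕ.≤-trans (coordSum-mono k U⊆V) (ℕ.m≤n+m _ (toℕ (g k)))
  coordSum-mono {U = g ∷ U} k (refl ∷ U⊆V) = ℕ.+-monoʳ-≤ (toℕ (g k)) (coordSum-mono k U⊆V)

  coordSum-units : ∀ j L → coordSum j (map unit L) ≤ count j L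
  coordSum-units j []      = z≤n
  coordSum-units j (k ∷ L) = ℕ.+-mono-≤ (unit-coordinate k j) (coordSum-units j L)

  -- a non-empty subsequence starting with e_k has k-th coordinate sum in [1, M_k - 1]
  standard-zeroSumFree : ZeroSumFree standard
  standard-zeroSumFree (u ∷ U) U⊆ _ zs with ∈-map⁻ unit (Any-resp-⊆ U⊆ (here refl))
  ... | k , k∈ , refl = ℕ.<⇒≱ below (ℕ.∣⇒≤ ⦃ ℕ.>-nonZero above ⦄ (zs k))
    where
      copies : 1 ≤ M k ∸ 1
      copies = subst (1 ≤_) (count-build (λ k → M k ∸ 1) k) (count-∈ k∈)
      1<M : 1 < M k
      1<M = ℕ.m∸n≢0⇒n<m (λ M∸1≡0 → ℕ.<⇒≱ (subst (1 ≤_) M∸1≡0 copies) z≤n)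
      above : 0 < coordSum k (unit k ∷ U)
      above = ℕ.≤-trans (ℕ.≤-reflexive (sym (unit-self k 1<M))) (ℕ.m≤m+n _ _)
      below : coordSum k (unit k ∷ U) < M k
      below = ℕ.≤-<-trans (coordSum-mono k U⊆) (ℕ.≤-<-trans (coordSum-units k (build (λ k → M k ∸ 1)))
        (subst (_< M k) (sym (count-build (λ k → M k ∸ 1) k)) (ℕ.∸-monoʳ-< {M k} {1} {0} (s≤s z≤n) (ℕ.<⇒≤ 1<M))))

  -- D* ≤ D(G): the standard sequence of length D* - 1 is zero-sumfree
  D*≤ : ∀ {D} → ForcesZeroSum p r e D → D* ≤ D
  D*≤ {D} forces = ℕ.≮⇒≥ λ D<D* →
    let (U , U⊆ , nonempty , zs) = forces standard (subst (D ≤_) (sym standard-length) (ℕ.≤-pred D<D*))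
    in standard-zeroSumFree U U⊆ nonempty zs

  isZero? : (g : Elem p r e) → Dec (IsZeroElem g)
  isZero? g = all? (λ k → toℕ (g k) ℕ.≟ 0)

  zeros nonzeros : Seq p r e → Seq p r e
  zeros []      = []
  zeros (g ∷ S) with isZero? g
  ... | yes _ = g ∷ zeros S
  ... | no _  = zeros S
  nonzeros []      = []
  nonzeros (g ∷ S) with isZero? g
  ... | yes _ = nonzeros S
  ... | no _  = g ∷ nonzeros S

  split-↭ : ∀ S → S ↭ zeros S ++ nonzeros S
  split-↭ []      = ↭-refl
  split-↭ (g ∷ S) with isZero? g
  ... | yes _ = prep g (split-↭ S)
  ... | no _  = ↭-trans (prep g (split-↭ S)) (↭-sym (shift g (zeros S) (nonzeros S)))

  zeros-zero : ∀ S → All IsZeroElem (zeros S)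
  zeros-zero []      = []
  zeros-zero (g ∷ S) with isZero? g
  ... | yes g≡0 = g≡0 ∷ zeros-zero S
  ... | no _    = zeros-zero S

  nonzeros-nonzero : ∀ S → All (λ g → ¬ IsZeroElem g) (nonzeros S)
  nonzeros-nonzero []      = []
  nonzeros-nonzero (g ∷ S) with isZero? g
  ... | yes _   = nonzeros-nonzero S
  ... | no g≢0  = g≢0 ∷ nonzeros-nonzero S

  withZeros : ∀ S U → U ⊆ nonzeros S →
    ∃[ U' ] (U' ⊆ S × length U' ≡ length U + length (zeros S) × ∀ k → coordSum k U' ≡ coordSum k U)
  withZeros []      U U⊆ = U , U⊆ , sym (ℕ.+-identityʳ _) , (λ _ → refl)
  withZeros (g ∷ S) U U⊆ with isZero? g
  withZeros (g ∷ S) U U⊆ | yes g≡0 with withZeros S U U⊆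
  ... | U' , U'⊆ , len , sums =
    g ∷ U' , refl ∷ U'⊆ , trans (cong suc len) (sym (ℕ.+-suc (length U) _)) ,
    λ k → trans (cong (_+ coordSum k U') (g≡0 k)) (sums k)
  withZeros (g ∷ S) (.g ∷ U) (refl ∷ U⊆) | no _ with withZeros S U U⊆
  ... | U' , U'⊆ , len , sums = g ∷ U' , refl ∷ U'⊆ , cong suc len , λ k → cong (toℕ (g k) +_) (sums k)
  withZeros (g ∷ S) U (.g ∷ʳ U⊆) | no _ with withZeros S U U⊆
  ... | U' , U'⊆ , len , sums = U' , g ∷ʳ U'⊆ , len , sums

  singleton-zeroSum : ∀ g → ZeroSum (g ∷ []) → IsZeroElem g
  singleton-zeroSum g zs k = reduced (toℕ (g k)) (toℕ<n (g k)) (subst (M k ℕ.∣_) (ℕ.+-identityʳ _) (zs k))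
    where reduced : ∀ a → a < M k → M k ℕ.∣ a → a ≡ 0
          reduced zero    _   _   = refl
          reduced (suc a) a<M M∣a = ⊥-elim (ℕ.<⇒≱ a<M (ℕ.∣⇒≤ M∣a))

  module NormalSequence {D} (isD : IsDavenport p r e D) {i} (1≤i : 1 ≤ i) (i≤p∸1 : i ≤ p ∸ 1)
                        {S : Seq p r e} (normal : Normal D S) (len : length S ≡ D + i ∸ 1) where
    open ℕ.≤-Reasoning

    Z T : Seq p r e
    Z = zeros S
    T = nonzeros S

    normal-bound : length S ∸ D + 1 ≡ i
    normal-bound = trans (cong (λ m → m ∸ D + 1) len) (cancel D i 1≤i)
      where
        cancel : ∀ D i → 1 ≤ i → (D + i ∸ 1) ∸ D + 1 ≡ i
        cancel D (suc i) _ = begin-equality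
          (D + suc i ∸ 1) ∸ D + 1  ≡⟨ cong (λ m → m ∸ 1 ∸ D + 1) (ℕ.+-suc D i) ⟩
          (D + i) ∸ D + 1          ≡⟨ cong (_+ 1) (ℕ.m+n∸m≡n D i) ⟩
          i + 1                    ≡⟨ ℕ.+-comm i 1 ⟩
          suc i                    ∎

    room : ∀ U → U ⊆ T → ZeroSum U → length U + length Z ≤ i
    room U U⊆T zs with withZeros S U U⊆T
    ... | U' , U'⊆S , len' , sums =
      subst₂ _≤_ len' normal-bound (proj₂ normal U' U'⊆S (λ k → subst (M k ℕ.∣_) (sym (sums k)) (zs k)))

    zeros-at-most : length Z ≤ i
    zeros-at-most = room [] (minimum T) (λ k → M k ℕ.∣0)

    module FewZeros (j<i : length Z < i) where
      j b : ℕ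
      j = length Z
      b = i ∸ suc j

      i≡ : suc j + b ≡ i
      i≡ = ℕ.m+[n∸m]≡n j<i

      T-length : length T ≡ D ∸ 1 + suc b
      T-length = ℕ.+-cancelˡ-≡ j _ _ (begin-equality
        j + length T          ≡⟨ trans (sym (List.length-++ Z)) (sym (↭-length (split-↭ S))) ⟩
        length S              ≡⟨ len ⟩
        D + i ∸ 1             ≡⟨ cong (λ d → d + i ∸ 1) (sym (ℕ.m+[n∸m]≡n (proj₁ isD))) ⟩
        D ∸ 1 + i             ≡⟨ cong (D ∸ 1 +_) (sym i≡) ⟩
        D ∸ 1 + (suc j + b)   ≡⟨ rearrange (D ∸ 1) j b ⟩
        j + (D ∸ 1 + suc b)   ∎)
        where rearrange : ∀ c j b → c + (suc j + b) ≡ j + (c + suc b)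
              rearrange = solve-∀

      D*≤D : D* ≤ suc (D ∸ 1)
      D*≤D = subst (D* ≤_) (sym (ℕ.m+[n∸m]≡n (proj₁ isD))) (D*≤ (proj₁ (proj₂ isD)))

      b+1<p : suc b < p
      b+1<p = begin-strict
        suc b        ≤⟨ ℕ.+-monoˡ-≤ b (s≤s z≤n) ⟩
        suc j + b    ≡⟨ i≡ ⟩
        i            ≤⟨ i≤p∸1 ⟩
        p ∸ 1        <⟨ ℕ.∸-monoʳ-< {p} {1} {0} (s≤s z≤n) (ℕ.>-nonZero⁻¹ p ⦃ prime⇒nonZero isPrime ⦄) ⟩
        p            ∎

      -- T has no zero terms, so no zero-sum subsequence of length 1
      at-least-two : ∀ U → U ⊆ T → 1 ≤ length U → IsZeroSum U → 2 ≤ length U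
      at-least-two (g ∷ [])    U⊆T _ zs with All-resp-⊆ U⊆T (nonzeros-nonzero S)
      ... | g≢0 ∷ [] = ⊥-elim (g≢0 (singleton-zeroSum g (⇒zeroSum {g ∷ []} zs)))
      at-least-two (_ ∷ _ ∷ _) _   _ _  = s≤s (s≤s z≤n)

      at-most-b+1 : ∀ U → U ⊆ T → IsZeroSum U → length U ≤ suc b
      at-most-b+1 U U⊆T zs = ℕ.+-cancelʳ-≤ j (length U) (suc b) (begin
        length U + j    ≤⟨ room U U⊆T (⇒zeroSum {U} zs) ⟩
        i               ≡⟨ i≡ ⟨
        suc j + b       ≡⟨ cong suc (ℕ.+-comm j b) ⟩
        suc b + j       ∎)

      contradiction : ⊥
      contradiction = no-medium-zero-sums T (D ∸ 1) b T-length D*≤D b+1<p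
        (λ U U⊆T nonempty zs → at-least-two U U⊆T nonempty zs , at-most-b+1 U U⊆T zs)

    zeros-at-least : i ≤ length Z
    zeros-at-least = ℕ.≮⇒≥ FewZeros.contradiction

    zeros-exactly : length Z ≡ i
    zeros-exactly = ℕ.≤-antisym zeros-at-most zeros-at-least

    -- with exactly i zeros, normality leaves no room for a zero-sum U ⊆ T
    T-zeroSumFree : ZeroSumFree T
    T-zeroSumFree U U⊆T nonempty zs = ℕ.<-irrefl refl (begin-strict
      length Z           <⟨ ℕ.+-monoˡ-≤ (length Z) nonempty ⟩
      length U + length Z ≤⟨ room U U⊆T zs ⟩
      i                  ≡⟨ zeros-exactly ⟨
      length Z           ∎)

open import Data.Nat using (_+_; _∸_; _≤_)
open import Data.List using (length; _++_)
open import Data.List.Relation.Unary.All using (All)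
open import Data.List.Relation.Binary.Permutation.Propositional using (_↭_)
open import Data.Product using (_×_; _,_)

corollary2p2 : (p : ℕ) → Prime p → (r : ℕ) (e : Fin r → ℕ) →
    (D : ℕ) → IsDavenport p r e D →
    (i : ℕ) → 1 ≤ i → i ≤ p ∸ 1 →
    (S : Seq p r e) → Normal D S → length S ≡ D + i ∸ 1 →
    ∃[ Z ] ∃[ T ] (S ↭ Z ++ T × length Z ≡ i × All IsZeroElem Z × ZeroSumFree T)
corollary2p2 p isPrime r e D isD i 1≤i i≤p∸1 S normal len =
  Z , T , split-↭ S , zeros-exactly , zeros-zero S , T-zeroSumFree
  where
    open Group p isPrime r e
    open NormalSequence isD 1≤i i≤p∸1 normal len
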